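{- Let $m$ be an even positive integer and let $\xi$ be a primitive $2m^2$-th root of unity. Then $\sum_{x=0}^{m^2-1}\xi^{ -x(x-m)}=m$. -}

module Defs where

open import Level using (Level; _⊔_; suc)
open import Algebra.Bundles using (CommutativeRing; Semiring)
open import Data.Nat using (ℕ; zero; _<_)
import Data.Nat as ℕ
open import Data.Integer using (ℤ; +_; -[1+_])
open import Data.Product using (∃)
import Data.Product as P
open import Relation.Nullary using (¬_)

record Field (c ℓ : Level) : Set (suc (c ⊔ ℓ)) where
  field
    commutativeRing : CommutativeRing c ℓ
  open CommutativeRing commutativeRing public
  field
    0≉1     : ¬ (0# ≈ 1#)
    inverse : ∀ x → ¬ (x ≈ 0#) → ∃ λ y → x * y ≈ 1#

module FieldDefs {c ℓ} (F : Field c ℓ) where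
  open Field F
  open import Algebra.Definitions.RawSemiring (Semiring.rawSemiring semiring) public
    using (_^_; _×_; sum)

  IsPrimitiveRoot : Carrier → ℕ → Set ℓ
  IsPrimitiveRoot ξ n = (ξ ^ n ≈ 1#) P.× ((k : ℕ) → 0 < k → k < n → ¬ (ξ ^ k ≈ 1#))

  zpow : Carrier → Carrier → ℤ → Carrier
  zpow ξ ξ⁻¹ (+ n)      = ξ ^ n
  zpow ξ ξ⁻¹ -[1+ n ]   = ξ⁻¹ ^ ℕ.suc n

-- Write x < m² as x = m b + a with a, b < m and put d = m − a. Then
-- x² + a d + 2 m d b = x m + m² b (b + 1), and m² b (b + 1) is a multiple of
-- 2m² because b (b + 1) is even; hence ξ^(−x(x−m)) = ξ^(a d) · (ξ^(2 m d))^b.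
-- Summing over b first, ξ^(2 m d) is an m-th root of unity which is 1 only
-- for a = 0, so every geometric sum over b vanishes except the one for a = 0,
-- which equals m.
module Submission where

open import Defs
open import Algebra.Bundles using (Monoid; Semiring)
open import Data.Nat using (ℕ; zero; suc)
import Data.Nat as ℕ
import Data.Nat.Properties as ℕ
open import Data.Nat.Divisibility using (_∣_; divides; _∣0; ∣m∣n⇒∣m+n; m∣m*n; *-monoʳ-∣)
import Data.Nat.Tactic.RingSolver as ℕ-Solver
open import Data.Integer using (+_; -[1+_])
import Data.Integer as ℤ
import Data.Integer.Properties as ℤ
import Data.Integer.Tactic.RingSolver as ℤ-Solver
open import Data.Fin using (Fin; toℕ; combine; _↑ˡ_; _↑ʳ_; inject₁; fromℕ)
import Data.Fin as Fin
open import Data.Fin.Properties using (toℕ-inject₁; toℕ-fromℕ; toℕ-combine; toℕ<n)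
open import Data.List using ([]; _∷_)
open import Data.Product using (_,_; proj₁; proj₂)
open import Function using (_∘_)
open import Relation.Binary.PropositionalEquality as ≡ using (_≡_)
open import Relation.Nullary using (¬_)
import Relation.Binary.Reasoning.Setoid as SetoidReasoning

2∣n*[1+n] : ∀ n → 2 ∣ n ℕ.* suc n
2∣n*[1+n] zero    = 2 ∣0
2∣n*[1+n] (suc n) =
  ≡.subst (2 ∣_) (next n) (∣m∣n⇒∣m+n (2∣n*[1+n] n) (m∣m*n {2} (suc n)))
  where
  next : ∀ n → n ℕ.* suc n ℕ.+ 2 ℕ.* suc n ≡ suc n ℕ.* suc (suc n)
  next = ℕ-Solver.solve-∀

square-identity : ∀ {m a d} b → a ℕ.+ d ≡ m →
  (m ℕ.* b ℕ.+ a) ℕ.* (m ℕ.* b ℕ.+ a) ℕ.+ (a ℕ.* d ℕ.+ 2 ℕ.* m ℕ.* d ℕ.* b)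
    ≡ (m ℕ.* b ℕ.+ a) ℕ.* m ℕ.+ m ℕ.* m ℕ.* (b ℕ.* suc b)
square-identity {a = a} {d} b ≡.refl = ℕ-Solver.solve (a ∷ d ∷ b ∷ [])

module _ {c ℓ} (M : Monoid c ℓ) where
  open Monoid M
    renaming (_∙_ to _+_; ε to 0#; ∙-congˡ to +-congˡ; identityˡ to +-identityˡ;
              identityʳ to +-identityʳ; assoc to +-assoc)
  open import Algebra.Properties.Monoid.Sum M using (sum; sum-cong-≋; sum-replicate-zero)

  sum-↑ : ∀ {n k} (f : Fin (n ℕ.+ k) → Carrier) →
          sum f ≈ sum (f ∘ (_↑ˡ k)) + sum (f ∘ (n ↑ʳ_))
  sum-↑ {zero}  f = sym (+-identityˡ _)
  sum-↑ {suc n} f = trans (+-congˡ (sum-↑ {n} (f ∘ Fin.suc))) (sym (+-assoc _ _ _))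

  sum-combine : ∀ {m n} (f : Fin (m ℕ.* n) → Carrier) →
                sum f ≈ sum {m} (λ i → sum {n} (λ j → f (combine i j)))
  sum-combine {zero}      f = refl
  sum-combine {suc m} {n} f = trans (sum-↑ {n} f) (+-congˡ (sum-combine {m} (f ∘ (n ↑ʳ_))))

  sum-tail≈0 : ∀ {n} (f : Fin (suc n) → Carrier) →
               (∀ i → f (Fin.suc i) ≈ 0#) → sum f ≈ f Fin.zero
  sum-tail≈0 {n} f tail≈0 =
    trans (+-congˡ (trans (sum-cong-≋ tail≈0) (sum-replicate-zero n))) (+-identityʳ _)

module _ {c ℓ} (R : Semiring c ℓ) where
  open Semiring R
  open import Algebra.Definitions.RawSemiring rawSemiring using (_^_)
  open import Algebra.Properties.Semiring.Sum R using (sum; sum-cong-≋; *-distribˡ-sum; sum-init-last)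
  open import Algebra.Properties.Semiring.Exp R using (^-congʳ)
  open SetoidReasoning setoid

  geometric-sum : ∀ u n →
    u * sum {n} (λ i → u ^ toℕ i) + 1# ≈ sum {n} (λ i → u ^ toℕ i) + u ^ n
  geometric-sum u n = begin
    u * sum {n} (λ i → u ^ toℕ i) + 1#  ≈⟨ +-comm _ 1# ⟩
    1# + u * sum {n} (λ i → u ^ toℕ i)  ≈⟨ +-congˡ (*-distribˡ-sum {n} u (λ i → u ^ toℕ i)) ⟩
    sum {suc n} (λ i → u ^ toℕ i)       ≈⟨ sum-init-last {n} (λ i → u ^ toℕ i) ⟩
    sum {n} (λ i → u ^ toℕ (inject₁ i)) + u ^ toℕ (fromℕ n)
      ≈⟨ +-cong (sum-cong-≋ {n} (λ i → ^-congʳ u (toℕ-inject₁ i))) (^-congʳ u (toℕ-fromℕ n)) ⟩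
    sum {n} (λ i → u ^ toℕ i) + u ^ n   ∎

module _ {c ℓ} (F : Field c ℓ) where
  open Field F
  open FieldDefs F
  open import Algebra.Properties.Semiring.Sum semiring using (sum-cong-≋; sum-replicate; ∑-comm; *-distribˡ-sum)
  open import Algebra.Properties.Semiring.Exp semiring using (^-homo-*; ^-assocʳ; ^-congˡ; ^-congʳ)
  open import Algebra.Properties.CommutativeSemiring.Exp commutativeSemiring using (^-distrib-*)
  open import Algebra.Properties.Ring ring using (-1*x≈-x)
  open import Algebra.Properties.Group +-group using (∙-cancelʳ; x∙y⁻¹≈ε⇒x≈y)
  open SetoidReasoning setoid

  x≉0∧x*y≈0⇒y≈0 : ∀ {x y} → ¬ x ≈ 0# → x * y ≈ 0# → y ≈ 0#
  x≉0∧x*y≈0⇒y≈0 {x} {y} x≉0 x*y≈0 with inverse x x≉0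
  ... | x⁻¹ , x*x⁻¹≈1 = begin
    y                ≈⟨ *-identityˡ y ⟨
    1# * y           ≈⟨ *-congʳ x*x⁻¹≈1 ⟨
    (x * x⁻¹) * y    ≈⟨ *-congʳ (*-comm x x⁻¹) ⟩
    (x⁻¹ * x) * y    ≈⟨ *-assoc x⁻¹ x y ⟩
    x⁻¹ * (x * y)    ≈⟨ *-congˡ x*y≈0 ⟩
    x⁻¹ * 0#         ≈⟨ zeroʳ x⁻¹ ⟩
    0#               ∎

  geometric-sum≈0 : ∀ {u} n → u ^ n ≈ 1# → ¬ u ≈ 1# → sum {n} (λ i → u ^ toℕ i) ≈ 0#
  geometric-sum≈0 {u} n uⁿ≈1 u≉1 = x≉0∧x*y≈0⇒y≈0 u-1≉0 (begin
    (u - 1#) * S      ≈⟨ distribʳ S u (- 1#) ⟩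
    u * S + - 1# * S  ≈⟨ +-cong u*S≈S (-1*x≈-x S) ⟩
    S - S             ≈⟨ -‿inverseʳ S ⟩
    0#                ∎)
    where
    S = sum {n} (λ i → u ^ toℕ i)
    u*S≈S : u * S ≈ S
    u*S≈S = ∙-cancelʳ 1# (u * S) S (trans (geometric-sum semiring u n) (+-congˡ uⁿ≈1))
    u-1≉0 : ¬ u - 1# ≈ 0#
    u-1≉0 u-1≈0 = u≉1 (x∙y⁻¹≈ε⇒x≈y u 1# u-1≈0)

  1#^n≈1# : ∀ n → 1# ^ n ≈ 1#
  1#^n≈1# zero    = refl
  1#^n≈1# (suc n) = trans (*-identityˡ _) (1#^n≈1# n)

  ^≈1⇒^-multiple≈1 : ∀ {x n k} → x ^ n ≈ 1# → n ∣ k → x ^ k ≈ 1#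
  ^≈1⇒^-multiple≈1 {x} {n} xⁿ≈1 (divides q ≡.refl) = begin
    x ^ (q ℕ.* n)  ≡⟨ ≡.cong (x ^_) (ℕ.*-comm q n) ⟩
    x ^ (n ℕ.* q)  ≈⟨ ^-assocʳ x n q ⟨
    (x ^ n) ^ q    ≈⟨ ^-congˡ q xⁿ≈1 ⟩
    1# ^ q         ≈⟨ 1#^n≈1# q ⟩
    1#             ∎

  module _ {ξ ξ⁻¹ : Carrier} (ξ*ξ⁻¹≈1 : ξ * ξ⁻¹ ≈ 1#) where

    ^*⁻¹^≈1 : ∀ n → ξ ^ n * ξ⁻¹ ^ n ≈ 1#
    ^*⁻¹^≈1 n = trans (sym (^-distrib-* ξ ξ⁻¹ n)) (trans (^-congˡ n ξ*ξ⁻¹≈1) (1#^n≈1# n))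

    *-^-cancelʳ : ∀ {x y} n → x * ξ ^ n ≈ y * ξ ^ n → x ≈ y
    *-^-cancelʳ {x} {y} n x*ξⁿ≈y*ξⁿ = begin
      x                      ≈⟨ *-identityʳ x ⟨
      x * 1#                 ≈⟨ *-congˡ (^*⁻¹^≈1 n) ⟨
      x * (ξ ^ n * ξ⁻¹ ^ n)  ≈⟨ *-assoc x _ _ ⟨
      (x * ξ ^ n) * ξ⁻¹ ^ n  ≈⟨ *-congʳ x*ξⁿ≈y*ξⁿ ⟩
      (y * ξ ^ n) * ξ⁻¹ ^ n  ≈⟨ *-assoc y _ _ ⟩
      y * (ξ ^ n * ξ⁻¹ ^ n)  ≈⟨ *-congˡ (^*⁻¹^≈1 n) ⟩
      y * 1#                 ≈⟨ *-identityʳ y ⟩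
      y                      ∎

    zpow-*-^ : ∀ z p q → z ℤ.+ + p ≡ + q → zpow ξ ξ⁻¹ z * ξ ^ p ≈ ξ ^ q
    zpow-*-^ (+ n)    p q eq = trans (sym (^-homo-* ξ n p)) (^-congʳ ξ (ℤ.+-injective eq))
    zpow-*-^ -[1+ n ] p q eq = begin
      ξ⁻¹ ^ suc n * ξ ^ p                ≡⟨ ≡.cong (λ k → ξ⁻¹ ^ suc n * ξ ^ k) p≡1+n+q ⟩
      ξ⁻¹ ^ suc n * ξ ^ (suc n ℕ.+ q)    ≈⟨ *-congˡ (^-homo-* ξ (suc n) q) ⟩
      ξ⁻¹ ^ suc n * (ξ ^ suc n * ξ ^ q)  ≈⟨ *-assoc _ _ _ ⟨
      (ξ⁻¹ ^ suc n * ξ ^ suc n) * ξ ^ q  ≈⟨ *-congʳ (trans (*-comm _ _) (^*⁻¹^≈1 (suc n))) ⟩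
      1# * ξ ^ q                         ≈⟨ *-identityˡ _ ⟩
      ξ ^ q                              ∎
      where
      -a+b+a≡b : ∀ a b → (ℤ.- a ℤ.+ b) ℤ.+ a ≡ b
      -a+b+a≡b = ℤ-Solver.solve-∀
      p≡1+n+q : p ≡ suc n ℕ.+ q
      p≡1+n+q = ℤ.+-injective (≡.trans (≡.sym (-a+b+a≡b (+ suc n) (+ p)))
                                        (≡.trans (≡.cong (ℤ._+ + suc n) eq) (ℤ.+-comm (+ q) (+ suc n))))

  module QuadraticSum (m : ℕ) {ξ ξ⁻¹ : Carrier}
                      (prim : IsPrimitiveRoot ξ (2 ℕ.* (m ℕ.* m))) (ξ*ξ⁻¹≈1 : ξ * ξ⁻¹ ≈ 1#) where

    term : ℕ → Carrier
    term x = zpow ξ ξ⁻¹ (ℤ.- (+ x ℤ.* (+ x ℤ.- + m)))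

    ratio : ℕ → Carrier
    ratio a = ξ ^ (2 ℕ.* m ℕ.* (m ℕ.∸ a))

    term*ξ^x²≈ξ^xm : ∀ x → term x * ξ ^ (x ℕ.* x) ≈ ξ ^ (x ℕ.* m)
    term*ξ^x²≈ξ^xm x =
      zpow-*-^ {ξ} {ξ⁻¹} ξ*ξ⁻¹≈1 (ℤ.- (+ x ℤ.* (+ x ℤ.- + m))) (x ℕ.* x) (x ℕ.* m) exponents
      where
      -[x[x-m]]+x²≡xm : ∀ x m → ℤ.- (x ℤ.* (x ℤ.- m)) ℤ.+ x ℤ.* x ≡ x ℤ.* m
      -[x[x-m]]+x²≡xm = ℤ-Solver.solve-∀
      exponents : ℤ.- (+ x ℤ.* (+ x ℤ.- + m)) ℤ.+ + (x ℕ.* x) ≡ + (x ℕ.* m)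
      exponents rewrite ℤ.pos-* x x | ℤ.pos-* x m = -[x[x-m]]+x²≡xm (+ x) (+ m)

    ξ^[m²b[b+1]]≈1 : ∀ b → ξ ^ (m ℕ.* m ℕ.* (b ℕ.* suc b)) ≈ 1#
    ξ^[m²b[b+1]]≈1 b = ^≈1⇒^-multiple≈1 (proj₁ prim)
      (≡.subst (_∣ m ℕ.* m ℕ.* (b ℕ.* suc b)) (ℕ.*-comm (m ℕ.* m) 2)
               (*-monoʳ-∣ (m ℕ.* m) (2∣n*[1+n] b)))

    term-decomposition : ∀ {a d} b → a ℕ.+ d ≡ m →
      term (m ℕ.* b ℕ.+ a) ≈ ξ ^ (a ℕ.* d) * (ξ ^ (2 ℕ.* m ℕ.* d)) ^ b
    -- Multiplying both sides by the unit ξ^(x²) leaves only natural exponents.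
    term-decomposition {a} {d} b a+d≡m =
      *-^-cancelʳ {ξ} {ξ⁻¹} ξ*ξ⁻¹≈1 (x ℕ.* x) (trans (term*ξ^x²≈ξ^xm x) (sym (begin
        ξ ^ (a ℕ.* d) * (ξ ^ (2 ℕ.* m ℕ.* d)) ^ b * ξ ^ (x ℕ.* x)
          ≈⟨ *-congʳ (*-congˡ (^-assocʳ ξ (2 ℕ.* m ℕ.* d) b)) ⟩
        ξ ^ (a ℕ.* d) * ξ ^ (2 ℕ.* m ℕ.* d ℕ.* b) * ξ ^ (x ℕ.* x)
          ≈⟨ *-congʳ (^-homo-* ξ (a ℕ.* d) _) ⟨
        ξ ^ e * ξ ^ (x ℕ.* x)                         ≈⟨ ^-homo-* ξ e (x ℕ.* x) ⟨
        ξ ^ (e ℕ.+ x ℕ.* x)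
          ≡⟨ ≡.cong (ξ ^_) (≡.trans (ℕ.+-comm e (x ℕ.* x)) (square-identity b a+d≡m)) ⟩
        ξ ^ (x ℕ.* m ℕ.+ m ℕ.* m ℕ.* (b ℕ.* suc b))   ≈⟨ ^-homo-* ξ (x ℕ.* m) _ ⟩
        ξ ^ (x ℕ.* m) * ξ ^ (m ℕ.* m ℕ.* (b ℕ.* suc b)) ≈⟨ *-congˡ (ξ^[m²b[b+1]]≈1 b) ⟩
        ξ ^ (x ℕ.* m) * 1#                            ≈⟨ *-identityʳ _ ⟩
        ξ ^ (x ℕ.* m)                                 ∎)))
      where
      x = m ℕ.* b ℕ.+ a
      e = a ℕ.* d ℕ.+ 2 ℕ.* m ℕ.* d ℕ.* b

    ratio0≈1 : ratio 0 ≈ 1#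
    ratio0≈1 = trans (^-congʳ ξ (ℕ.*-assoc 2 m m)) (proj₁ prim)

    ratio^m≈1 : ∀ a → ratio a ^ m ≈ 1#
    ratio^m≈1 a = trans (^-assocʳ ξ (2 ℕ.* m ℕ.* d) m)
                        (^≈1⇒^-multiple≈1 (proj₁ prim) (divides d (regroup m d)))
      where
      d = m ℕ.∸ a
      regroup : ∀ m d → 2 ℕ.* m ℕ.* d ℕ.* m ≡ d ℕ.* (2 ℕ.* (m ℕ.* m))
      regroup = ℕ-Solver.solve-∀

    ratio≉1 : ∀ {a} → 0 ℕ.< a → a ℕ.< m → ¬ ratio a ≈ 1#
    ratio≉1 {a} 0<a a<m = proj₂ prim (2 ℕ.* m ℕ.* d) 0<2md 2md<2m²
      where
      d = m ℕ.∸ a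
      instance
        m≢0 : ℕ.NonZero m
        m≢0 = ℕ.>-nonZero (ℕ.<-trans 0<a a<m)
        d≢0 : ℕ.NonZero d
        d≢0 = ℕ.>-nonZero (ℕ.m<n⇒0<n∸m a<m)
      0<2md : 0 ℕ.< 2 ℕ.* m ℕ.* d
      0<2md = ℕ.>-nonZero⁻¹ _ {{ℕ.m*n≢0 (2 ℕ.* m) d {{ℕ.m*n≢0 2 m}}}}
      2md<2m² : 2 ℕ.* m ℕ.* d ℕ.< 2 ℕ.* (m ℕ.* m)
      2md<2m² = ≡.subst (2 ℕ.* m ℕ.* d ℕ.<_) (ℕ.*-assoc 2 m m)
                        (ℕ.*-monoʳ-< (2 ℕ.* m) {{ℕ.m*n≢0 2 m}} (ℕ.∸-monoʳ-< 0<a (ℕ.<⇒≤ a<m)))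

    column : ℕ → Carrier
    column a = ξ ^ (a ℕ.* (m ℕ.∸ a)) * sum {m} (λ b → ratio a ^ toℕ b)

    column0≈m : column 0 ≈ m × 1#
    column0≈m = begin
      1# * sum {m} (λ b → ratio 0 ^ toℕ b)  ≈⟨ *-identityˡ _ ⟩
      sum {m} (λ b → ratio 0 ^ toℕ b)       ≈⟨ sum-cong-≋ {m} (λ b → ^-congˡ (toℕ b) ratio0≈1) ⟩
      sum {m} (λ b → 1# ^ toℕ b)            ≈⟨ sum-cong-≋ {m} (λ b → 1#^n≈1# (toℕ b)) ⟩
      sum {m} (λ _ → 1#)                    ≈⟨ sum-replicate m ⟩
      m × 1#                                ∎

    column≈0 : ∀ {a} → 0 ℕ.< a → a ℕ.< m → column a ≈ 0#
    column≈0 {a} 0<a a<m =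
      trans (*-congˡ (geometric-sum≈0 m (ratio^m≈1 a) (ratio≉1 0<a a<m))) (zeroʳ _)

    sum-by-columns : sum {m ℕ.* m} (λ x → term (toℕ x)) ≈ sum {m} (λ a → column (toℕ a))
    sum-by-columns = begin
      sum {m ℕ.* m} (λ x → term (toℕ x))
        ≈⟨ sum-combine +-monoid {m} {m} (λ x → term (toℕ x)) ⟩
      sum {m} (λ b → sum {m} (λ a → term (toℕ (combine b a))))
        ≈⟨ sum-cong-≋ {m} (λ b → sum-cong-≋ {m} (λ a → entry b a)) ⟩
      sum {m} (λ b → sum {m} (λ a → ξ ^ (toℕ a ℕ.* (m ℕ.∸ toℕ a)) * ratio (toℕ a) ^ toℕ b))
        ≈⟨ ∑-comm {m} {m} _ ⟩
      sum {m} (λ a → sum {m} (λ b → ξ ^ (toℕ a ℕ.* (m ℕ.∸ toℕ a)) * ratio (toℕ a) ^ toℕ b))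
        ≈⟨ sum-cong-≋ {m} (λ a → *-distribˡ-sum {m} _ (λ b → ratio (toℕ a) ^ toℕ b)) ⟨
      sum {m} (λ a → column (toℕ a)) ∎
      where
      entry : ∀ (b a : Fin m) →
        term (toℕ (combine b a)) ≈ ξ ^ (toℕ a ℕ.* (m ℕ.∸ toℕ a)) * ratio (toℕ a) ^ toℕ b
      entry b a = trans (reflexive (≡.cong term (toℕ-combine b a)))
                        (term-decomposition (toℕ b) (ℕ.m+[n∸m]≡n (ℕ.<⇒≤ (toℕ<n a))))

lemma6p2 : ∀ {c ℓ} (F : Field c ℓ) → let open Field F in let open FieldDefs F in
    (m : ℕ) → 0 ℕ.< m → 2 ∣ m →
    (ξ ξ⁻¹ : Carrier) → IsPrimitiveRoot ξ (2 ℕ.* (m ℕ.* m)) → ξ * ξ⁻¹ ≈ 1# →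
    sum {m ℕ.* m} (λ x → zpow ξ ξ⁻¹ (ℤ.- (+ toℕ x ℤ.* (+ toℕ x ℤ.- + m)))) ≈ m × 1#
lemma6p2 F m@(suc _) _ _ ξ ξ⁻¹ prim ξ*ξ⁻¹≈1 = begin
  sum {m ℕ.* m} (λ x → term (toℕ x))  ≈⟨ sum-by-columns ⟩
  sum {m} (λ a → column (toℕ a))      ≈⟨ sum-tail≈0 +-monoid (column ∘ toℕ) column-suc≈0 ⟩
  column 0                            ≈⟨ column0≈m ⟩
  m × 1#                              ∎
  where
  open Field F
  open FieldDefs F
  open SetoidReasoning setoid
  open QuadraticSum F m prim ξ*ξ⁻¹≈1
  column-suc≈0 : ∀ a → column (toℕ (Fin.suc a)) ≈ 0#
  column-suc≈0 a = column≈0 ℕ.z<s (toℕ<n (Fin.suc a))
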